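{- For all $n\ge1$ and $d\ge3$, $m_{d,n}=\left\lceil\frac{(d-1)(n-1)}{2}\right\rceil$, where $m_{d,n}$ is defined in the context.
   Context: $S_n$ is the set of permutations of $\{0,\dots,n-1\}$ in one-line notation. For $d\ge2$, $S^d_n$ is the set of $(d-1)$-tuples $\Pi=(\pi^2,\dots,\pi^d)$ of elements of $S_n$, with elements (columns) $\Pi_j=(\pi^2_j,\dots,\pi^d_j)^T$. The (sum) level is $\mathrm{lev}(\Pi_j)=\pi^2_j+\dots+\pi^d_j$, and $\mathrm{lev}_{\max}(\Pi)=\max_j\mathrm{lev}(\Pi_j)$. Define $m_{d,n}=\min\{\mathrm{lev}_{\max}(\Pi):\Pi\in S^d_n\}$. -}

module Defs where

open import Data.Nat using (ℕ; _+_; _⊔_; _∸_)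
open import Data.Fin using (Fin; toℕ)
open import Data.Fin.Permutation using (Permutation′; _⟨$⟩ʳ_)
open import Data.Vec using (Vec; map; foldr; allFin)

-- S_n : permutations of {0,…,n-1}; π in one-line notation is j ↦ toℕ (π ⟨$⟩ʳ j).
-- S^d_n : (d-1)-tuples (π², …, π^d) of permutations, as a vector of length d ∸ 1.
Tuple : ℕ → ℕ → Set
Tuple d n = Vec (Permutation′ n) (d ∸ 1)

lev : ∀ d {n} → Tuple d n → Fin n → ℕ
lev d Π j = foldr _ _+_ 0 (map (λ π → toℕ (π ⟨$⟩ʳ j)) Π)

-- lev_max(Π) = max_j lev(Π_j)   (max over the empty set taken as 0; n ≥ 1 in the theorem)
levMax : ∀ d {n} → Tuple d n → ℕ
levMax d {n} Π = foldr _ _⊔_ 0 (map (lev d Π) (allFin n))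

IsMinLevMax : ℕ → ℕ → ℕ → Set
IsMinLevMax d n m = Σ' × Lb
  where
  open import Data.Product using (_×_; ∃)
  open import Data.Nat using (_≤_)
  open import Relation.Binary.PropositionalEquality using (_≡_)
  Σ' = ∃ λ (Π : Tuple d n) → levMax d Π ≡ m
  Lb = ∀ (Π : Tuple d n) → m ≤ levMax d Π

-- Lower bound: each row of Π is a permutation, so the levels of the n columns add up to
-- (d-1)(0 + 1 + ... + (n-1)) = (d-1)n(n-1)/2, and the largest level is at least the
-- average (d-1)(n-1)/2.
-- Upper bound: a row π together with its reverse n-1-π contributes exactly n-1 to every
-- column, which settles an even number d-1 of rows.  For odd d-1 one adds a triple of rows
-- whose column sums are as balanced as possible: for n = 2m+1 the rows x, x+m mod n and
-- 2m - (2x mod n) sum to 3m in every column x, and for n = 2m+2 one prepends a fixed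
-- point 0 to the last two of these rows and uses the cyclic shift x ↦ x-1 as first row.
module Submission where

open import Defs
open import Data.Nat using (ℕ; zero; suc; _+_; _*_; _∸_; _≤_; _<_; _⊔_; z≤n; s≤s; NonZero; ⌈_/2⌉)
open import Data.Nat.Properties
open import Data.Nat.DivMod using (_%_; m%n<n; m<n⇒m%n≡m; [m+n]%n≡m%n; [m+kn]%n≡m%n; %-distribˡ-+; %-distribˡ-*; m%n%n≡m%n)
open import Data.Nat.Tactic.RingSolver using (solve-∀)
open import Data.Fin using (Fin; zero; suc; toℕ; fromℕ<; opposite)
open import Data.Fin.Properties using (toℕ-fromℕ<; toℕ<n; toℕ-injective; opposite-prop)
open import Data.Fin.Permutation using (Permutation′; _⟨$⟩ʳ_; permutation; reverse; lift₀; _∘ₚ_; id)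
open import Data.Vec as Vec using (Vec; []; _∷_; lookup; allFin; foldr; map)
open import Data.Vec.Properties using (lookup-map; lookup-allFin)
open import Data.Product using (Σ-syntax; _,_)
open import Relation.Binary.PropositionalEquality
open import Relation.Nullary using (yes; no)
open import Function using (_∘_)
open import Algebra.Properties.CommutativeMonoid.Sum +-0-commutativeMonoid
  using (sum-syntax; sum-permute; sum-cong-≗; ∑-distrib-+; sum-replicate-zero)

module _ (N : ℕ) .{{_ : NonZero N}} where

  [m%n+o]%n≡[m+o]%n : ∀ m o → (m % N + o) % N ≡ (m + o) % N
  [m%n+o]%n≡[m+o]%n m o = begin
    (m % N + o) % N          ≡⟨ %-distribˡ-+ (m % N) o N ⟩
    (m % N % N + o % N) % N  ≡⟨ cong (λ z → (z + o % N) % N) (m%n%n≡m%n m N) ⟩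
    (m % N + o % N) % N      ≡⟨ %-distribˡ-+ m o N ⟨
    (m + o) % N              ∎
    where open ≡-Reasoning

  [o*[m%n]]%n≡[o*m]%n : ∀ o m → (o * (m % N)) % N ≡ (o * m) % N
  [o*[m%n]]%n≡[o*m]%n o m = begin
    (o * (m % N)) % N          ≡⟨ %-distribˡ-* o (m % N) N ⟩
    (o % N * (m % N % N)) % N  ≡⟨ cong (λ z → (o % N * z) % N) (m%n%n≡m%n m N) ⟩
    (o % N * (m % N)) % N      ≡⟨ %-distribˡ-* o m N ⟨
    (o * m) % N                ∎
    where open ≡-Reasoning

  permutation% : (f g : ℕ → ℕ) →
                 (∀ x → x < N → g (f x % N) % N ≡ x) →
                 (∀ y → y < N → f (g y % N) % N ≡ y) → Permutation′ N
  permutation% f g g∘f f∘g = permutation (reduce f) (reduce g)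
    (λ y → toℕ-injective (inverse f g f∘g y))
    (λ x → toℕ-injective (inverse g f g∘f x))
    where
    reduce : (ℕ → ℕ) → Fin N → Fin N
    reduce h x = fromℕ< (m%n<n (h (toℕ x)) N)
    inverse : ∀ h k → (∀ y → y < N → h (k y % N) % N ≡ y) → ∀ y → toℕ (reduce h (reduce k y)) ≡ toℕ y
    inverse h k h∘k y = begin
      toℕ (reduce h (reduce k y))  ≡⟨ toℕ-fromℕ< _ ⟩
      h (toℕ (reduce k y)) % N     ≡⟨ cong (λ z → h z % N) (toℕ-fromℕ< _) ⟩
      h (k (toℕ y) % N) % N        ≡⟨ h∘k (toℕ y) (toℕ<n y) ⟩
      toℕ y                        ∎
      where open ≡-Reasoning

  rotation-inverse : ∀ {r s} → r + s ≡ N → ∀ x → x < N → ((x + r) % N + s) % N ≡ x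
  rotation-inverse {r} {s} r+s≡N x x<N = begin
    ((x + r) % N + s) % N  ≡⟨ [m%n+o]%n≡[m+o]%n (x + r) s ⟩
    (x + r + s) % N        ≡⟨ cong (_% N) (trans (+-assoc x r s) (cong (x +_) r+s≡N)) ⟩
    (x + N) % N            ≡⟨ [m+n]%n≡m%n x N ⟩
    x % N                  ≡⟨ m<n⇒m%n≡m x<N ⟩
    x                      ∎
    where open ≡-Reasoning

  rotation : (r : ℕ) → r ≤ N → Permutation′ N
  rotation r r≤N = permutation% (_+ r) (_+ (N ∸ r))
    (rotation-inverse (m+[n∸m]≡n r≤N))
    (rotation-inverse (m∸n+n≡m r≤N))

  toℕ-rotation : ∀ r r≤N x → toℕ (rotation r r≤N ⟨$⟩ʳ x) ≡ (toℕ x + r) % N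
  toℕ-rotation r r≤N x = toℕ-fromℕ< _

  scaling-inverse : ∀ {a b} → a * b ≡ suc N → ∀ x → x < N → (b * ((a * x) % N)) % N ≡ x
  scaling-inverse {a} {b} a*b≡1+N x x<N = begin
    (b * ((a * x) % N)) % N  ≡⟨ [o*[m%n]]%n≡[o*m]%n b (a * x) ⟩
    (b * (a * x)) % N        ≡⟨ cong (_% N) (b*[a*x]≡x*[a*b] a b x) ⟩
    (x * (a * b)) % N        ≡⟨ cong (λ c → (x * c) % N) a*b≡1+N ⟩
    (x * suc N) % N          ≡⟨ cong (_% N) (*-suc x N) ⟩
    (x + x * N) % N          ≡⟨ [m+kn]%n≡m%n x x N ⟩
    x % N                    ≡⟨ m<n⇒m%n≡m x<N ⟩
    x                        ∎
    where
    open ≡-Reasoning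
    b*[a*x]≡x*[a*b] : ∀ a b x → b * (a * x) ≡ x * (a * b)
    b*[a*x]≡x*[a*b] = solve-∀

doubling : (m : ℕ) → Permutation′ (suc (2 * m))
doubling m = permutation% (suc (2 * m)) (2 *_) (suc m *_)
  (scaling-inverse (suc (2 * m)) {2} {suc m} (2*[1+m]≡2+2*m m))
  (scaling-inverse (suc (2 * m)) {suc m} {2} (trans (*-comm (suc m) 2) (2*[1+m]≡2+2*m m)))
  where
  2*[1+m]≡2+2*m : ∀ m → 2 * suc m ≡ suc (suc (2 * m))
  2*[1+m]≡2+2*m = solve-∀

toℕ-doubling : ∀ m x → toℕ (doubling m ⟨$⟩ʳ x) ≡ (2 * toℕ x) % suc (2 * m)
toℕ-doubling m x = toℕ-fromℕ< _

m≤1+2m : ∀ m → m ≤ suc (2 * m)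
m≤1+2m m = m≤n⇒m≤1+n (m≤m+n m (m + 0))

x+[x+m]%n≡m+[2x]%n : ∀ m x → x < suc (2 * m) → x + (x + m) % suc (2 * m) ≡ m + (2 * x) % suc (2 * m)
x+[x+m]%n≡m+[2x]%n m x x<N with x ≤? m
... | yes x≤m = begin
  x + (x + m) % N  ≡⟨ cong (x +_) (m<n⇒m%n≡m (s≤s (≤-trans (+-monoˡ-≤ m x≤m) m+m≤2m))) ⟩
  x + (x + m)      ≡⟨ x+[x+m]≡m+2x x m ⟩
  m + 2 * x        ≡⟨ cong (m +_) (m<n⇒m%n≡m (s≤s (*-monoʳ-≤ 2 x≤m))) ⟨
  m + (2 * x) % N  ∎
  where
  open ≡-Reasoning
  N = suc (2 * m)
  m+m≤2m : m + m ≤ 2 * m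
  m+m≤2m = ≤-reflexive (cong (m +_) (sym (+-identityʳ m)))
  x+[x+m]≡m+2x : ∀ x m → x + (x + m) ≡ m + 2 * x
  x+[x+m]≡m+2x = solve-∀
... | no x≰m with m≤n⇒∃[o]m+o≡n (≰⇒> x≰m)
...   | y , refl = begin
  suc m + y + (suc m + y + m) % N  ≡⟨ cong (suc m + y +_) ([a+N]%N≡a y (suc m + y + m) y<N (1+m+y+m≡y+N m y)) ⟩
  suc m + y + y                    ≡⟨ 1+m+y+y≡m+[1+2y] m y ⟩
  m + suc (2 * y)                  ≡⟨ cong (m +_) ([a+N]%N≡a (suc (2 * y)) (2 * (suc m + y)) 1+2y<N (2[1+m+y]≡1+2y+N m y)) ⟨
  m + (2 * (suc m + y)) % N        ∎
  where
  open ≡-Reasoning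
  N = suc (2 * m)
  [a+N]%N≡a : ∀ a b → a < N → b ≡ a + N → b % N ≡ a
  [a+N]%N≡a a b a<N refl = trans ([m+n]%n≡m%n a N) (m<n⇒m%n≡m a<N)
  1+m+y+m≡y+N : ∀ m y → suc m + y + m ≡ y + suc (2 * m)
  1+m+y+m≡y+N = solve-∀
  1+m+y+y≡m+[1+2y] : ∀ m y → suc m + y + y ≡ m + suc (2 * y)
  1+m+y+y≡m+[1+2y] = solve-∀
  2[1+m+y]≡1+2y+N : ∀ m y → 2 * (suc m + y) ≡ suc (2 * y) + suc (2 * m)
  2[1+m+y]≡1+2y+N = solve-∀
  y<m : y < m
  y<m = +-cancelˡ-< (suc m) y m (subst (suc m + y <_) (1+2m≡1+m+m m) x<N)
    where
    1+2m≡1+m+m : ∀ m → suc (2 * m) ≡ suc m + m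
    1+2m≡1+m+m = solve-∀
  y<N : y < N
  y<N = ≤-trans y<m (m≤1+2m m)
  1+2y<N : suc (2 * y) < N
  1+2y<N = s≤s (*-monoʳ-< 2 y<m)

-- lev with the number of rows as index: lev d Π is columnSum Π by definition.
columnSum : ∀ {k n} → Vec (Permutation′ n) k → Fin n → ℕ
columnSum Π j = Vec.sum (map (λ π → toℕ (π ⟨$⟩ʳ j)) Π)

halfRotation : ∀ m → Permutation′ (suc (2 * m))
halfRotation m = rotation (suc (2 * m)) m (m≤1+2m m)

toℕ-halfRotation : ∀ m x → toℕ (halfRotation m ⟨$⟩ʳ x) ≡ (toℕ x + m) % suc (2 * m)
toℕ-halfRotation m = toℕ-rotation (suc (2 * m)) m (m≤1+2m m)

reflectedDoubling : ∀ m → Permutation′ (suc (2 * m))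
reflectedDoubling m = doubling m ∘ₚ reverse

toℕ-reflectedDoubling : ∀ m x → toℕ (reflectedDoubling m ⟨$⟩ʳ x) ≡ 2 * m ∸ (2 * toℕ x) % suc (2 * m)
toℕ-reflectedDoubling m x = trans (opposite-prop (doubling m ⟨$⟩ʳ x)) (cong (2 * m ∸_) (toℕ-doubling m x))

oddTriple : ∀ m → Vec (Permutation′ (suc (2 * m))) 3
oddTriple m = id ∷ halfRotation m ∷ reflectedDoubling m ∷ []

columnSum-oddTriple : ∀ m x → columnSum (oddTriple m) x ≡ 3 * m
columnSum-oddTriple m x = begin
  toℕ x + (toℕ (halfRotation m ⟨$⟩ʳ x) + (toℕ (reflectedDoubling m ⟨$⟩ʳ x) + 0))
    ≡⟨ cong₂ (λ b c → toℕ x + (b + c)) (toℕ-halfRotation m x) (trans (+-identityʳ _) (toℕ-reflectedDoubling m x)) ⟩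
  toℕ x + ((toℕ x + m) % N + (2 * m ∸ 2x%N))
    ≡⟨ +-assoc (toℕ x) _ _ ⟨
  toℕ x + (toℕ x + m) % N + (2 * m ∸ 2x%N)
    ≡⟨ cong (_+ (2 * m ∸ 2x%N)) (x+[x+m]%n≡m+[2x]%n m (toℕ x) (toℕ<n x)) ⟩
  m + 2x%N + (2 * m ∸ 2x%N)
    ≡⟨ +-assoc m 2x%N _ ⟩
  m + (2x%N + (2 * m ∸ 2x%N))
    ≡⟨ cong (m +_) (m+[n∸m]≡n (≤-pred (m%n<n (2 * toℕ x) N))) ⟩
  m + 2 * m
    ≡⟨ m+2m≡3m m ⟩
  3 * m ∎
  where
  open ≡-Reasoning
  N = suc (2 * m)
  2x%N = (2 * toℕ x) % N
  m+2m≡3m : ∀ m → m + 2 * m ≡ 3 * m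
  m+2m≡3m = solve-∀

cyclicPred : ∀ n → Permutation′ (suc n)
cyclicPred n = rotation (suc n) n (n≤1+n n)

toℕ-cyclicPred-zero : ∀ n → toℕ (cyclicPred n ⟨$⟩ʳ zero) ≡ n
toℕ-cyclicPred-zero n = trans (toℕ-rotation (suc n) n (n≤1+n n) zero) (m<n⇒m%n≡m ≤-refl)

toℕ-cyclicPred-suc : ∀ n i → toℕ (cyclicPred n ⟨$⟩ʳ suc i) ≡ toℕ i
toℕ-cyclicPred-suc n i = begin
  toℕ (cyclicPred n ⟨$⟩ʳ suc i)  ≡⟨ toℕ-rotation (suc n) n (n≤1+n n) (suc i) ⟩
  (suc (toℕ i) + n) % suc n      ≡⟨ cong (_% suc n) (+-suc (toℕ i) n) ⟨
  (toℕ i + suc n) % suc n        ≡⟨ [m+n]%n≡m%n (toℕ i) (suc n) ⟩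
  toℕ i % suc n                  ≡⟨ m<n⇒m%n≡m (m<n⇒m<1+n (toℕ<n i)) ⟩
  toℕ i                          ∎
  where open ≡-Reasoning

columnSum-lift₀-zero : ∀ {k n} (Π : Vec (Permutation′ n) k) → columnSum (map lift₀ Π) zero ≡ 0
columnSum-lift₀-zero []      = refl
columnSum-lift₀-zero (π ∷ Π) = columnSum-lift₀-zero Π

columnSum-lift₀-suc : ∀ {k n} (Π : Vec (Permutation′ n) k) i → columnSum (map lift₀ Π) (suc i) ≡ k + columnSum Π i
columnSum-lift₀-suc []      i = refl
columnSum-lift₀-suc {suc k} (π ∷ Π) i = begin
  suc (toℕ (π ⟨$⟩ʳ i)) + columnSum (map lift₀ Π) (suc i)  ≡⟨ cong (suc (toℕ (π ⟨$⟩ʳ i)) +_) (columnSum-lift₀-suc Π i) ⟩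
  suc (toℕ (π ⟨$⟩ʳ i)) + (k + columnSum Π i)              ≡⟨ cong suc (x+[k+y]≡k+[x+y] (toℕ (π ⟨$⟩ʳ i)) k _) ⟩
  suc (k + (toℕ (π ⟨$⟩ʳ i) + columnSum Π i))              ∎
  where
  open ≡-Reasoning
  x+[k+y]≡k+[x+y] : ∀ x k y → x + (k + y) ≡ k + (x + y)
  x+[k+y]≡k+[x+y] = solve-∀

evenTriple : ∀ m → Vec (Permutation′ (suc (suc (2 * m)))) 3
evenTriple m = cyclicPred (suc (2 * m)) ∷ map lift₀ (halfRotation m ∷ reflectedDoubling m ∷ [])

columnSum-evenTriple-zero : ∀ m → columnSum (evenTriple m) zero ≡ suc (2 * m)
columnSum-evenTriple-zero m = trans
  (cong₂ _+_ (toℕ-cyclicPred-zero (suc (2 * m))) (columnSum-lift₀-zero (halfRotation m ∷ reflectedDoubling m ∷ [])))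
  (+-identityʳ _)

columnSum-evenTriple-suc : ∀ m i → columnSum (evenTriple m) (suc i) ≡ 2 + 3 * m
columnSum-evenTriple-suc m i = begin
  toℕ (cyclicPred (suc (2 * m)) ⟨$⟩ʳ suc i) + columnSum (map lift₀ tail) (suc i)
    ≡⟨ cong₂ _+_ (toℕ-cyclicPred-suc (suc (2 * m)) i) (columnSum-lift₀-suc tail i) ⟩
  toℕ i + (2 + columnSum tail i)
    ≡⟨ x+[2+y]≡2+[x+y] (toℕ i) (columnSum tail i) ⟩
  2 + columnSum (oddTriple m) i
    ≡⟨ cong (2 +_) (columnSum-oddTriple m i) ⟩
  2 + 3 * m ∎
  where
  open ≡-Reasoning
  tail = halfRotation m ∷ reflectedDoubling m ∷ []
  x+[2+y]≡2+[x+y] : ∀ x y → x + (2 + y) ≡ 2 + (x + y)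
  x+[2+y]≡2+[x+y] = solve-∀

⌈n+[n+m]/2⌉≡n+⌈m/2⌉ : ∀ n m → ⌈ n + (n + m) /2⌉ ≡ n + ⌈ m /2⌉
⌈n+[n+m]/2⌉≡n+⌈m/2⌉ zero    m = refl
⌈n+[n+m]/2⌉≡n+⌈m/2⌉ (suc n) m = begin
  ⌈ suc (n + suc (n + m)) /2⌉  ≡⟨ cong (λ k → ⌈ suc k /2⌉) (+-suc n (n + m)) ⟩
  suc ⌈ n + (n + m) /2⌉        ≡⟨ cong suc (⌈n+[n+m]/2⌉≡n+⌈m/2⌉ n m) ⟩
  suc (n + ⌈ m /2⌉)            ∎
  where open ≡-Reasoning

data Parity : ℕ → Set where
  even : ∀ m → Parity (2 * m)
  odd  : ∀ m → Parity (suc (2 * m))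

parity : ∀ n → Parity n
parity zero = even zero
parity (suc n) with parity n
... | even m = odd m
... | odd m  = subst Parity (2+2m≡2*[1+m] m) (even (suc m))
  where
  2+2m≡2*[1+m] : ∀ m → 2 * suc m ≡ suc (suc (2 * m))
  2+2m≡2*[1+m] = solve-∀

BalancedTuple : ℕ → ℕ → Set
BalancedTuple k n = Σ[ Π ∈ Vec (Permutation′ (suc n)) k ] ∀ j → columnSum Π j ≤ ⌈ k * n /2⌉

balancedTriple : ∀ n → BalancedTuple 3 n
balancedTriple n with parity n
... | even m = oddTriple m , λ j → ≤-reflexive (trans (columnSum-oddTriple m j) (sym ⌈3*2m/2⌉≡3m))
  where
  ⌈3*2m/2⌉≡3m : ⌈ 3 * (2 * m) /2⌉ ≡ 3 * m
  ⌈3*2m/2⌉≡3m = begin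
    ⌈ 3 * (2 * m) /2⌉              ≡⟨ cong ⌈_/2⌉ (3*2m≡3m+[3m+0] m) ⟩
    ⌈ 3 * m + (3 * m + 0) /2⌉      ≡⟨ ⌈n+[n+m]/2⌉≡n+⌈m/2⌉ (3 * m) 0 ⟩
    3 * m + 0                      ≡⟨ +-identityʳ (3 * m) ⟩
    3 * m                          ∎
    where
    open ≡-Reasoning
    3*2m≡3m+[3m+0] : ∀ m → 3 * (2 * m) ≡ 3 * m + (3 * m + 0)
    3*2m≡3m+[3m+0] = solve-∀
... | odd m = evenTriple m , bound
  where
  ⌈3*[1+2m]/2⌉≡2+3m : ⌈ 3 * suc (2 * m) /2⌉ ≡ 2 + 3 * m
  ⌈3*[1+2m]/2⌉≡2+3m = begin
    ⌈ 3 * suc (2 * m) /2⌉                  ≡⟨ cong ⌈_/2⌉ (3*[1+2m]≡k+[k+1] m) ⟩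
    ⌈ suc (3 * m) + (suc (3 * m) + 1) /2⌉  ≡⟨ ⌈n+[n+m]/2⌉≡n+⌈m/2⌉ (suc (3 * m)) 1 ⟩
    suc (3 * m) + 1                        ≡⟨ +-comm (suc (3 * m)) 1 ⟩
    2 + 3 * m                              ∎
    where
    open ≡-Reasoning
    3*[1+2m]≡k+[k+1] : ∀ m → 3 * suc (2 * m) ≡ suc (3 * m) + (suc (3 * m) + 1)
    3*[1+2m]≡k+[k+1] = solve-∀
  bound : ∀ j → columnSum (evenTriple m) j ≤ ⌈ 3 * suc (2 * m) /2⌉
  bound zero    = subst₂ _≤_ (sym (columnSum-evenTriple-zero m)) (sym ⌈3*[1+2m]/2⌉≡2+3m)
    (s≤s (m≤n⇒m≤1+n (*-monoˡ-≤ m (n≤1+n 2))))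
  bound (suc i) = ≤-reflexive (trans (columnSum-evenTriple-suc m i) (sym ⌈3*[1+2m]/2⌉≡2+3m))

toℕ+toℕ-opposite : ∀ {n} (j : Fin (suc n)) → toℕ j + toℕ (opposite j) ≡ n
toℕ+toℕ-opposite j = trans (cong (toℕ j +_) (opposite-prop j)) (m+[n∸m]≡n (≤-pred (toℕ<n j)))

prependComplementaryPair : ∀ {k n} → BalancedTuple k n → BalancedTuple (2 + k) n
prependComplementaryPair {k} {n} (Π , bound) = id ∷ reverse ∷ Π , bound′
  where
  bound′ : ∀ j → columnSum (id ∷ reverse ∷ Π) j ≤ ⌈ (2 + k) * n /2⌉
  bound′ j = begin
    toℕ j + (toℕ (opposite j) + columnSum Π j)  ≡⟨ +-assoc (toℕ j) _ _ ⟨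
    toℕ j + toℕ (opposite j) + columnSum Π j    ≡⟨ cong (_+ columnSum Π j) (toℕ+toℕ-opposite j) ⟩
    n + columnSum Π j                           ≤⟨ +-monoʳ-≤ n (bound j) ⟩
    n + ⌈ k * n /2⌉                             ≡⟨ ⌈n+[n+m]/2⌉≡n+⌈m/2⌉ n (k * n) ⟨
    ⌈ (2 + k) * n /2⌉                           ∎
    where open ≤-Reasoning

balancedTuple : ∀ e n → BalancedTuple (2 + e) n
balancedTuple zero          n = prependComplementaryPair ([] , λ _ → z≤n)
balancedTuple (suc zero)    n = balancedTriple n
balancedTuple (suc (suc e)) n = prependComplementaryPair (balancedTuple e n)

lookup≤foldr-⊔ : ∀ {k} (xs : Vec ℕ k) i → lookup xs i ≤ foldr _ _⊔_ 0 xs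
lookup≤foldr-⊔ (x ∷ xs) zero    = m≤m⊔n x _
lookup≤foldr-⊔ (x ∷ xs) (suc i) = m≤n⇒m≤o⊔n x (lookup≤foldr-⊔ xs i)

foldr-⊔-lub : ∀ {k B} (xs : Vec ℕ k) → (∀ i → lookup xs i ≤ B) → foldr _ _⊔_ 0 xs ≤ B
foldr-⊔-lub []       bound = z≤n
foldr-⊔-lub (x ∷ xs) bound = ⊔-lub (bound zero) (foldr-⊔-lub xs (bound ∘ suc))

lookup-map-allFin : ∀ {n} (f : Fin n → ℕ) j → lookup (map f (allFin n)) j ≡ f j
lookup-map-allFin f j = trans (lookup-map j f (allFin _)) (cong f (lookup-allFin j))

lev≤levMax : ∀ d {n} (Π : Tuple d n) j → lev d Π j ≤ levMax d Π
lev≤levMax d Π j = subst (_≤ levMax d Π) (lookup-map-allFin (lev d Π) j) (lookup≤foldr-⊔ (map (lev d Π) (allFin _)) j)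

levMax-lub : ∀ d {n} (Π : Tuple d n) {B} → (∀ j → lev d Π j ≤ B) → levMax d Π ≤ B
levMax-lub d Π {B} bound = foldr-⊔-lub (map (lev d Π) (allFin _)) (λ j → subst (_≤ B) (sym (lookup-map-allFin (lev d Π) j)) (bound j))

∑-mono-≤ : ∀ {n} {f g : Fin n → ℕ} → (∀ j → f j ≤ g j) → ∑[ j < n ] f j ≤ ∑[ j < n ] g j
∑-mono-≤ {zero}  f≤g = z≤n
∑-mono-≤ {suc n} f≤g = +-mono-≤ (f≤g zero) (∑-mono-≤ (f≤g ∘ suc))

∑-const : ∀ n c → ∑[ j < n ] c ≡ n * c
∑-const zero    c = refl
∑-const (suc n) c = cong (c +_) (∑-const n c)

∑-columnSum : ∀ {k n} (Π : Vec (Permutation′ n) k) → ∑[ j < n ] columnSum Π j ≡ k * ∑[ j < n ] toℕ j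
∑-columnSum {n = n} []      = sum-replicate-zero n
∑-columnSum {suc k} {n} (π ∷ Π) = begin
  ∑[ j < n ] (toℕ (π ⟨$⟩ʳ j) + columnSum Π j)              ≡⟨ ∑-distrib-+ (λ j → toℕ (π ⟨$⟩ʳ j)) (columnSum Π) ⟩
  ∑[ j < n ] toℕ (π ⟨$⟩ʳ j) + ∑[ j < n ] columnSum Π j     ≡⟨ cong₂ _+_ (sym (sum-permute toℕ π)) (∑-columnSum Π) ⟩
  ∑[ j < n ] toℕ j + k * ∑[ j < n ] toℕ j                  ∎
  where open ≡-Reasoning

2*∑toℕ≡n*[n-1] : ∀ n → ∑[ j < suc n ] toℕ j + ∑[ j < suc n ] toℕ j ≡ suc n * n
2*∑toℕ≡n*[n-1] n = begin
  ∑[ j < suc n ] toℕ j + ∑[ j < suc n ] toℕ j             ≡⟨ cong (∑[ j < suc n ] toℕ j +_) (sum-permute toℕ (reverse {suc n})) ⟩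
  ∑[ j < suc n ] toℕ j + ∑[ j < suc n ] toℕ (opposite j)  ≡⟨ ∑-distrib-+ {suc n} toℕ (toℕ ∘ opposite) ⟨
  ∑[ j < suc n ] (toℕ j + toℕ (opposite j))               ≡⟨ sum-cong-≗ {suc n} toℕ+toℕ-opposite ⟩
  ∑[ j < suc n ] n                                        ≡⟨ ∑-const (suc n) n ⟩
  suc n * n                                               ∎
  where open ≡-Reasoning

⌈[d∸1]*n/2⌉≤levMax : ∀ d {n} (Π : Tuple d (suc n)) → ⌈ (d ∸ 1) * n /2⌉ ≤ levMax d Π
⌈[d∸1]*n/2⌉≤levMax d {n} Π = begin
  ⌈ k * n /2⌉      ≤⟨ ⌈n/2⌉-mono (*-cancelˡ-≤ (suc n) n*kn≤n*2M) ⟩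
  ⌈ M + M /2⌉      ≡⟨ n≡⌈n+n/2⌉ M ⟨
  M                ∎
  where
  open ≤-Reasoning
  k = d ∸ 1
  M = levMax d Π
  T = ∑[ j < suc n ] toℕ j
  S = ∑[ j < suc n ] lev d Π j
  S≤n*M : S ≤ suc n * M
  S≤n*M = begin
    S                  ≤⟨ ∑-mono-≤ (lev≤levMax d Π) ⟩
    ∑[ j < suc n ] M   ≡⟨ ∑-const (suc n) M ⟩
    suc n * M          ∎
  n*kn≤n*2M : suc n * (k * n) ≤ suc n * (M + M)
  n*kn≤n*2M = begin
    suc n * (k * n)          ≡⟨ x*[y*z]≡y*[x*z] (suc n) k n ⟩
    k * (suc n * n)          ≡⟨ cong (k *_) (2*∑toℕ≡n*[n-1] n) ⟨
    k * (T + T)              ≡⟨ *-distribˡ-+ k T T ⟩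
    k * T + k * T            ≡⟨ cong (λ x → x + x) (∑-columnSum Π) ⟨
    S + S                    ≤⟨ +-mono-≤ S≤n*M S≤n*M ⟩
    suc n * M + suc n * M    ≡⟨ *-distribˡ-+ (suc n) M M ⟨
    suc n * (M + M)          ∎
    where
    x*[y*z]≡y*[x*z] : ∀ x y z → x * (y * z) ≡ y * (x * z)
    x*[y*z]≡y*[x*z] = solve-∀

theorem4p1 : ∀ (n d : ℕ) → 1 ≤ n → 3 ≤ d →
    IsMinLevMax d n ⌈ ((d ∸ 1) * (n ∸ 1)) /2⌉
theorem4p1 zero    _                        ()    _
theorem4p1 (suc n) 1                        _     (s≤s ())
theorem4p1 (suc n) 2                        _     (s≤s (s≤s ()))
theorem4p1 (suc n) d@(suc (suc (suc e))) _     _ with balancedTuple e n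
... | Π , columnSum≤ =
  (Π , ≤-antisym (levMax-lub d Π columnSum≤) (⌈[d∸1]*n/2⌉≤levMax d Π)) , ⌈[d∸1]*n/2⌉≤levMax d
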